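{- Suppose there exist $\epsilon>0$ and $K>0$ such that for every positive integer $n$, every linear tripartite 3-uniform hypergraph with three vertex classes each of size $n$ that is $(9,5)$-free has at most $Kn^{2-\epsilon}$ edges. Then there exist $\epsilon'>0$ and $K'>0$ such that for every positive integer $n$, every set $A\subseteq[n]$ containing no non-trivial solution to $2x+2y=z+3w$ satisfies $|A|\le K'n^{1-\epsilon'}$.
   Context: $[n]=\{1,\dots,n\}$. A 3-uniform hypergraph is linear if any two distinct edges share at most one vertex; it is tripartite with given vertex classes if every edge meets each class in exactly one vertex. A hypergraph is $(u,v)$-free if there is no collection of $v$ edges whose union contains at most $u$ vertices. A solution $(x,y,z,w)\in A^4$ of $2x+2y=z+3w$ is trivial if $x=y=z=w$, and non-trivial otherwise. -}

module Defs where

open import Data.Nat using (ℕ; zero; suc; _+_; _*_; _^_; _≤_; _<_)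
open import Data.Fin using (Fin)
import Data.Fin as Fin
import Data.Fin.Properties as FinP
open import Data.Product using (_×_; _,_; Σ; ∃)
import Data.Product.Properties as ProdP
open import Data.List using (List; []; _∷_; length; deduplicate; concatMap; filter)
import Data.List.Membership.DecPropositional as MemDP
open import Data.List.Relation.Unary.All using (All)
open import Data.List.Relation.Unary.Unique.Propositional using (Unique)
open import Data.List.Membership.Propositional using (_∈_)
open import Relation.Binary.PropositionalEquality using (_≡_)
open import Relation.Nullary using (¬_)

-- Tripartite 3-uniform hypergraph with vertex classes V₀, V₁, V₂, each a copy of Fin n.
-- An edge meets each class in exactly one vertex, so it is a triple (a , b , c).
Edge : ℕ → Set
Edge n = Fin n × Fin n × Fin n

-- A vertex: (class index, element of that class).  Classes are disjoint.
Vertex : ℕ → Set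
Vertex n = Fin 3 × Fin n

vertsOf : ∀ {n} → Edge n → List (Vertex n)
vertsOf (a , b , c) = (Fin.zero , a) ∷ (Fin.suc Fin.zero , b) ∷ (Fin.suc (Fin.suc Fin.zero) , c) ∷ []

unionVerts : ∀ {n} → List (Edge n) → List (Vertex n)
unionVerts {n} es = deduplicate (ProdP.≡-dec FinP._≟_ FinP._≟_) (concatMap vertsOf es)

record TripartiteHypergraph (n : ℕ) : Set where
  field
    edges  : List (Edge n)
    unique : Unique edges

open TripartiteHypergraph public

numEdges : ∀ {n} → TripartiteHypergraph n → ℕ
numEdges H = length (edges H)

sharedVerts : ∀ {n} → Edge n → Edge n → List (Vertex n)
sharedVerts e f = filter (λ v → MemDP._∈?_ (ProdP.≡-dec FinP._≟_ FinP._≟_) v (vertsOf f)) (vertsOf e)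

Linear : ∀ {n} → TripartiteHypergraph n → Set
Linear H = ∀ e f → e ∈ edges H → f ∈ edges H → ¬ (e ≡ f) →
           length (sharedVerts e f) ≤ 1

Free : ∀ {n} → ℕ → ℕ → TripartiteHypergraph n → Set
Free {n} u v H = ¬ (Σ (List (Edge n)) λ S →
                   length S ≡ v × Unique S × All (_∈ edges H) S ×
                   length (unionVerts S) ≤ u)

SubsetOfRange : ℕ → List ℕ → Set
SubsetOfRange n A = Unique A × All (λ x → 1 ≤ x × x ≤ n) A

HasNontrivialSolution : List ℕ → Set
HasNontrivialSolution A =
  ∃ λ x → ∃ λ y → ∃ λ z → ∃ λ w →
    x ∈ A × y ∈ A × z ∈ A × w ∈ A ×
    2 * x + 2 * y ≡ z + 3 * w ×
    ¬ (x ≡ y × y ≡ z × z ≡ w)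

-- Take the tripartite hypergraph on three copies of [0, 3N) whose edges are the triples
-- (x, x + a, x + 2a) with a ∈ A and x < N. It has |A| N edges, and it is linear because two
-- vertices of an edge determine (a , x). If three edges met pairwise in three different classes,
-- their slopes would satisfy 2a = b + c with a, b, c ∈ A, i.e. give the non-trivial solution
-- (b, a, c, b). Five edges on at most nine vertices repeat at least six of their fifteen
-- vertex occurrences. Recording, for each class, which of the five edges share their vertex there,
-- an exhaustive check over triples of equivalence relations on five points shows that every
-- linear, rainbow-free configuration with six repetitions contains edges p, q and u, v, w such
-- that p meets u, v, w in classes 0, 1, 2 and q meets them in classes 1, 2, 0. This forces
-- 2 a_u + 2 a_w = a_v + 3 a_p, again a non-trivial solution. So the hypergraph is (9,5)-free, and
-- the hypothesis on it, with 3N vertices per class, becomes |A|^b N^a ≤ (9K)^b N^b.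

module Submission where

open import Defs
open import Data.Nat using (ℕ; _+_; _*_; _^_; _≤_; _<_)
open import Data.Product using (_×_; ∃)
open import Data.List using (List; length)
open import Relation.Nullary using (¬_)

open import Data.Bool using (Bool; true; false; T; not; _∧_; _∨_)
open import Data.Bool.ListAction using (all; any; or)
open import Data.Bool.Properties using (T?; T-∧; T-≡)
open import Data.Empty using (⊥; ⊥-elim)
open import Data.Fin using (Fin; zero; suc; toℕ)
open import Data.Fin.Patterns using (0F; 1F; 2F; 3F; 4F; 5F; 6F; 7F; 8F; 9F)
import Data.Fin.Properties as Fin
open import Data.List
  using ([]; _∷_; map; filter; concatMap; deduplicate; allFin; upTo; lookup; cartesianProduct; cartesianProductWith)
import Data.List.Membership.DecPropositional as DecMembership
open import Data.List.Membership.Propositional using (_∈_)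
open import Data.List.Membership.Propositional.Properties
  using (∈-filter⁺; ∈-cartesianProductWith⁺; ∈-cartesianProduct⁻; ∈-map⁻; ∈-upTo⁻; ∈-lookup;
         deduplicate-∈⇔)
open import Data.List.Properties using (filter-all; length-map; length-upTo; length-++)
open import Data.List.Relation.Unary.All as All using (All)
open import Data.List.Relation.Unary.All.Properties using (all⁺; all⁻)
import Data.List.Relation.Unary.All.Properties as All
open import Data.List.Relation.Unary.Any using (here; there; satisfied)
open import Data.List.Relation.Unary.Any.Properties using (any⁻)
open import Data.List.Relation.Unary.Unique.Propositional using (Unique)
import Data.List.Relation.Unary.Unique.Propositional.Properties as Unique
open import Data.List.Relation.Unary.Unique.DecPropositional.Properties using (deduplicate-!)
open import Data.Nat using (zero; suc; NonZero; _≤ᵇ_; z≤n; s≤s; >-nonZero; >-nonZero⁻¹)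
open import Data.Nat.DivMod using (_mod_; m<n⇒m%n≡m)
open import Data.Nat.Properties
  using (+-comm; +-assoc; *-comm; *-assoc; +-cancelˡ-≡; +-cancelʳ-≡; *-cancelˡ-≡; +-cancelˡ-≤; *-cancelˡ-≤;
         +-monoˡ-≤; +-mono-≤-<; *-mono-≤; *-monoʳ-≤; *-monoʳ-<; ^-monoˡ-≤; ^-*-assoc; m≤n*m; m*n≢0; m^n≢0;
         [m*n]*[o*p]≡[m*o]*[n*p]; m≤n⇒∃[o]m+o≡n; <-cmp; ≤⇒≤ᵇ; module ≤-Reasoning)
open import Data.Nat.Tactic.RingSolver using (solve; solve-∀)
open import Data.Product using (_,_; proj₁; proj₂)
import Data.Product.Properties as Product
open import Data.Unit using (tt)
open import Function using (Equivalence; _∘_; mk⇔)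
open import Relation.Binary using (DecidableEquality; tri<; tri≈; tri>)
open import Relation.Binary.PropositionalEquality
  using (_≡_; _≢_; refl; sym; trans; cong; cong₂; subst; subst₂; module ≡-Reasoning)
open import Relation.Nullary using (Dec; yes; no; does; ¬?; contradiction)
open import Relation.Nullary.Decidable using (dec-true; does-⇔)

slopes-differ⇒≡ : ∀ {c d a b x y} → c < d →
                  c * a + x ≡ c * b + y → d * a + x ≡ d * b + y → a ≡ b
slopes-differ⇒≡ {c} {d} {a} {b} {x} {y} c<d e₁ e₂ with e , refl ← m≤n⇒∃[o]m+o≡n c<d =
  sym (*-cancelˡ-≡ b a (suc e) (+-cancelʳ-≡ (c * a + c * b + x + y) _ _ (begin
    suc e * b + (c * a + c * b + x + y)  ≡⟨ solve (c ∷ e ∷ a ∷ b ∷ x ∷ y ∷ []) ⟩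
    (c * a + x) + ((suc c + e) * b + y)  ≡⟨ cong₂ _+_ e₁ (sym e₂) ⟩
    (c * b + y) + ((suc c + e) * a + x)  ≡⟨ solve (c ∷ e ∷ a ∷ b ∷ x ∷ y ∷ []) ⟩
    suc e * a + (c * a + c * b + x + y)  ∎)))
  where open ≡-Reasoning

value : Fin 3 → ℕ × ℕ → ℕ
value c (a , x) = toℕ c * a + x

Meet : Fin 3 → ℕ × ℕ → ℕ × ℕ → Set
Meet c p q = value c p ≡ value c q

meet-same-slope⇒≡ : ∀ c {a x b y} → Meet c (a , x) (b , y) → a ≡ b → (a , x) ≡ (b , y)
meet-same-slope⇒≡ c {a} e refl = cong (a ,_) (+-cancelˡ-≡ (toℕ c * a) _ _ e)

meet-twice⇒≡ : ∀ {c d p q} → c ≢ d → Meet c p q → Meet d p q → p ≡ q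
meet-twice⇒≡ {c} {d} c≢d e₁ e₂ with <-cmp (toℕ c) (toℕ d)
... | tri< c<d _ _ = meet-same-slope⇒≡ c e₁ (slopes-differ⇒≡ c<d e₁ e₂)
... | tri≈ _ c≡d _ = contradiction (Fin.toℕ-injective c≡d) c≢d
... | tri> _ _ d<c = meet-same-slope⇒≡ c e₁ (slopes-differ⇒≡ d<c e₂ e₁)

rainbow⇒progression : ∀ {p q r} → Meet 0F p q → Meet 1F q r → Meet 2F p r →
                      proj₁ p + proj₁ p ≡ proj₁ q + proj₁ r
rainbow⇒progression {a , x} {b , .x} {c , z} refl q∼₁r p∼₂r = +-cancelʳ-≡ (c + (x + z)) _ _ (begin
  (a + a) + (c + (x + z))    ≡⟨ solve (a ∷ x ∷ c ∷ z ∷ []) ⟩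
  (2 * a + x) + (1 * c + z)  ≡⟨ cong₂ _+_ p∼₂r (sym q∼₁r) ⟩
  (2 * c + z) + (1 * b + x)  ≡⟨ solve (b ∷ x ∷ c ∷ z ∷ []) ⟩
  (b + c) + (c + (x + z))    ∎)
  where open ≡-Reasoning

-- The sum of q∼₁u (twice), p∼₂w, p∼₁v and q∼₂v reversed: everything but the slopes cancels.
template⇒solution : ∀ {p q u v w} →
  Meet 0F p u → Meet 1F p v → Meet 2F p w → Meet 1F q u → Meet 2F q v → Meet 0F q w →
  2 * proj₁ u + 2 * proj₁ w ≡ proj₁ v + 3 * proj₁ p
template⇒solution {a , x} {b , y} {c , .x} {d , z} {e , .y} refl p∼₁v p∼₂w q∼₁u q∼₂v refl =
  +-cancelʳ-≡ (2 * b + 2 * y + 2 * x + z + d) _ _ (begin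
    (2 * c + 2 * e) + (2 * b + 2 * y + 2 * x + z + d)
      ≡⟨ solve (b ∷ c ∷ d ∷ e ∷ x ∷ y ∷ z ∷ []) ⟩
    2 * (1 * c + x) + (2 * e + y) + ((1 * d + z) + (2 * b + y))
      ≡⟨ cong₂ _+_ (cong₂ _+_ (cong (2 *_) (sym q∼₁u)) (sym p∼₂w)) (cong₂ _+_ (sym p∼₁v) q∼₂v) ⟩
    2 * (1 * b + y) + (2 * a + x) + ((1 * a + x) + (2 * d + z))
      ≡⟨ solve (a ∷ b ∷ d ∷ x ∷ y ∷ z ∷ []) ⟩
    (d + 3 * a) + (2 * b + 2 * y + 2 * x + z + d)
      ∎)
  where open ≡-Reasoning

progression⇒solution : ∀ a b c → b + b ≡ a + c → 2 * a + 2 * b ≡ c + 3 * a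
progression⇒solution a b c eq = begin
  2 * a + 2 * b      ≡⟨ solve (a ∷ b ∷ []) ⟩
  (a + a) + (b + b)  ≡⟨ cong ((a + a) +_) eq ⟩
  (a + a) + (a + c)  ≡⟨ solve (a ∷ c ∷ []) ⟩
  c + 3 * a          ∎
  where open ≡-Reasoning

complement-≥ : ∀ {m n o p} → m + n ≡ o + p → m ≤ o → p ≤ n
complement-≥ {m} {n} {o} {p} eq m≤o = +-cancelˡ-≤ o p n (subst (_≤ o + n) eq (+-monoˡ-≤ n m≤o))

^-distribʳ-* : ∀ m n o → (m * n) ^ o ≡ m ^ o * n ^ o
^-distribʳ-* m n zero    = refl
^-distribʳ-* m n (suc o) =
  trans (cong (m * n *_) (^-distribʳ-* m n o)) ([m*n]*[o*p]≡[m*o]*[n*p] m n (m ^ o) (n ^ o))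

tripled-bound : ∀ L N K a b .{{_ : NonZero N}} →
                (L * N) ^ b * (3 * N) ^ a ≤ K ^ b * (3 * N) ^ (2 * b) →
                L ^ b * N ^ a ≤ (9 * K) ^ b * N ^ b
tripled-bound L N K a b bound = *-cancelˡ-≤ (N ^ b) {{m^n≢0 N b}} (begin
  N ^ b * (L ^ b * N ^ a)        ≡⟨ sym (*-assoc (N ^ b) (L ^ b) (N ^ a)) ⟩
  N ^ b * L ^ b * N ^ a          ≡⟨ cong (_* N ^ a) (trans (*-comm (N ^ b) (L ^ b)) (sym (^-distribʳ-* L N b))) ⟩
  (L * N) ^ b * N ^ a            ≤⟨ *-monoʳ-≤ ((L * N) ^ b) (^-monoˡ-≤ a (m≤n*m N 3)) ⟩
  (L * N) ^ b * (3 * N) ^ a      ≤⟨ bound ⟩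
  K ^ b * (3 * N) ^ (2 * b)      ≡⟨ cong (K ^ b *_) (sym (^-*-assoc (3 * N) 2 b)) ⟩
  K ^ b * ((3 * N) ^ 2) ^ b      ≡⟨ sym (^-distribʳ-* K ((3 * N) ^ 2) b) ⟩
  (K * (3 * N) ^ 2) ^ b          ≡⟨ cong (_^ b) (square-scaling K N) ⟩
  (N * (9 * K * N)) ^ b          ≡⟨ ^-distribʳ-* N (9 * K * N) b ⟩
  N ^ b * (9 * K * N) ^ b        ≡⟨ cong (N ^ b *_) (^-distribʳ-* (9 * K) N b) ⟩
  N ^ b * ((9 * K) ^ b * N ^ b)  ∎)
  where
  open ≤-Reasoning
  square-scaling : ∀ K N → K * (3 * N * (3 * N * 1)) ≡ N * (9 * K * N)
  square-scaling = solve-∀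

-- Opened only here: these constructors would make the variable lists given to `solve` above ambiguous.
open import Data.List.Relation.Unary.All using ([]; _∷_)
open import Data.List.Relation.Unary.AllPairs using ([]; _∷_)
open import Data.Vec as Vec using (Vec; []; _∷_)

indicator : Bool → ℕ
indicator true  = 1
indicator false = 0

infixr 1 _⇒_

_⇒_ : Bool → Bool → Bool
a ⇒ b = not a ∨ b

⇒-intro : ∀ {a b} → (T a → T b) → T (a ⇒ b)
⇒-intro {true}  f = f tt
⇒-intro {false} _ = tt

⇒-elim : ∀ {a b} → T (a ⇒ b) → T a → T b
⇒-elim {true} t _ = t

∧-intro : ∀ {a b} → T a → T b → T (a ∧ b)
∧-intro ta tb = Equivalence.from T-∧ (ta , tb)

∧-elim : ∀ {a b} → T (a ∧ b) → T a × T b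
∧-elim = Equivalence.to T-∧

not-∧-intro : ∀ {a b} → (T a → T b → ⊥) → T (not (a ∧ b))
not-∧-intro {true}  {true}  f = f tt tt
not-∧-intro {true}  {false} _ = tt
not-∧-intro {false}         _ = tt

does⇒ : ∀ {P : Set} (p? : Dec P) → T (does p?) → P
does⇒ (yes p) _ = p

⇒does : ∀ {P : Set} (p? : Dec P) → P → T (does p?)
⇒does (yes _) _ = tt
⇒does (no ¬p) p = ¬p p

infix 4 _≠ᵇ_

_≠ᵇ_ : ∀ {n} → Fin n → Fin n → Bool
i ≠ᵇ k = not (does (i Fin.≟ k))

≠ᵇ⇒≢ : ∀ {n} {i k : Fin n} → T (i ≠ᵇ k) → i ≢ k
≠ᵇ⇒≢ {i = i} {k} t with i Fin.≟ k
... | no i≢k = i≢k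

∀ᵇ ∃ᵇ : ∀ {n} → (Fin n → Bool) → Bool
∀ᵇ {n} p = all p (allFin n)
∃ᵇ {n} p = any p (allFin n)

∀ᵇ-intro : ∀ {n} {p : Fin n → Bool} → (∀ i → T (p i)) → T (∀ᵇ p)
∀ᵇ-intro {n} {p} h = all⁻ p (All.tabulate {xs = allFin n} λ {i} _ → h i)

∃ᵇ-elim : ∀ {n} {p : Fin n → Bool} → T (∃ᵇ p) → ∃ λ i → T (p i)
∃ᵇ-elim {n} {p} t = satisfied (any⁻ p (allFin n) t)

allBoolVecs : ∀ n → List (Vec Bool n)
allBoolVecs zero    = [] ∷ []
allBoolVecs (suc n) = cartesianProductWith _∷_ (true ∷ false ∷ []) (allBoolVecs n)

∈-allBoolVecs : ∀ {n} (v : Vec Bool n) → v ∈ allBoolVecs n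
∈-allBoolVecs []      = here refl
∈-allBoolVecs (b ∷ v) = ∈-cartesianProductWith⁺ _∷_ (∈-bools b) (∈-allBoolVecs v)
  where
  ∈-bools : ∀ b → b ∈ true ∷ false ∷ []
  ∈-bools true  = here refl
  ∈-bools false = there (here refl)

length-filter-∷ : ∀ {A : Set} {P : A → Set} (P? : ∀ x → Dec (P x)) x xs →
                  length (filter P? (x ∷ xs)) ≡ indicator (does (P? x)) + length (filter P? xs)
length-filter-∷ P? x xs with does (P? x)
... | true  = refl
... | false = refl

length-cartesianProduct : ∀ {A B : Set} (xs : List A) (ys : List B) →
                          length (cartesianProduct xs ys) ≡ length xs * length ys
length-cartesianProduct []       ys = refl
length-cartesianProduct (x ∷ xs) ys = trans (length-++ (map (x ,_) ys))
  (cong₂ _+_ (length-map (x ,_) ys) (length-cartesianProduct xs ys))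

Unique-map⁺ : ∀ {A B : Set} {f : A → B} {xs : List A} →
              (∀ {x y} → x ∈ xs → y ∈ xs → f x ≡ f y → x ≡ y) → Unique xs → Unique (map f xs)
Unique-map⁺ {xs = []}     _   []           = []
Unique-map⁺ {xs = x ∷ xs} inj (x∉xs ∷ !xs) =
  All.map⁺ (All.tabulate λ y∈xs fx≡fy → All.lookup x∉xs y∈xs (inj (here refl) (there y∈xs) fx≡fy))
  ∷ Unique-map⁺ (λ x∈ y∈ → inj (there x∈) (there y∈)) !xs

Unique-lookup-injective : ∀ {A : Set} {xs : List A} → Unique xs →
                          ∀ {i j} → lookup xs i ≡ lookup xs j → i ≡ j
Unique-lookup-injective (_    ∷ _)    {zero}  {zero}  _  = refl
Unique-lookup-injective (x∉xs ∷ _)    {zero}  {suc j} eq = ⊥-elim (All.lookup x∉xs (∈-lookup j) eq)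
Unique-lookup-injective (x∉xs ∷ _)    {suc i} {zero}  eq = ⊥-elim (All.lookup x∉xs (∈-lookup i) (sym eq))
Unique-lookup-injective (_    ∷ !xs)  {suc i} {suc j} eq = cong suc (Unique-lookup-injective !xs eq)

module _ {A : Set} (_≟_ : DecidableEquality A) where
  open DecMembership _≟_ using (_∈?_)

  repeats : List A → ℕ
  repeats []       = 0
  repeats (x ∷ xs) = indicator (does (x ∈? xs)) + repeats xs

  private
    length-remove : ∀ x ys → Unique ys →
                    length (filter (¬? ∘ (x ≟_)) ys) + indicator (does (x ∈? ys)) ≡ length ys
    length-remove x []       _            = refl
    length-remove x (y ∷ ys) (x∉ys ∷ !ys) with x ≟ y
    ... | yes refl rewrite filter-all (¬? ∘ (x ≟_)) x∉ys = +-comm (length ys) 1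
    ... | no _     = cong suc (length-remove x ys !ys)

  length-deduplicate+repeats : ∀ xs → length (deduplicate _≟_ xs) + repeats xs ≡ length xs
  length-deduplicate+repeats []       = refl
  length-deduplicate+repeats (x ∷ xs) = cong suc (begin
    length R + (indicator (does (x ∈? xs)) + repeats xs)
      ≡⟨ cong (λ b → length R + (indicator b + repeats xs)) x∈xs≡x∈D ⟩
    length R + (indicator (does (x ∈? D)) + repeats xs)
      ≡⟨ sym (+-assoc (length R) _ _) ⟩
    length R + indicator (does (x ∈? D)) + repeats xs
      ≡⟨ cong (_+ repeats xs) (length-remove x D (deduplicate-! _≟_ xs)) ⟩
    length D + repeats xs
      ≡⟨ length-deduplicate+repeats xs ⟩
    length xs
      ∎)
    where
    open ≡-Reasoning
    D = deduplicate _≟_ xs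
    R = filter (¬? ∘ (x ≟_)) D
    x∈xs≡x∈D = does-⇔ (deduplicate-∈⇔ _≟_) (x ∈? xs) (x ∈? D)

-- The ten entries are indexed by the pairs i < k of five edges, in lexicographic order.
Pattern : Set
Pattern = Vec Bool 10

shares : Pattern → Fin 5 → Fin 5 → Bool
shares (b01 ∷ b02 ∷ b03 ∷ b04 ∷ b12 ∷ b13 ∷ b14 ∷ b23 ∷ b24 ∷ b34 ∷ []) = λ where
  0F 0F → true ; 0F 1F → b01  ; 0F 2F → b02  ; 0F 3F → b03  ; 0F 4F → b04
  1F 0F → b01  ; 1F 1F → true ; 1F 2F → b12  ; 1F 3F → b13  ; 1F 4F → b14
  2F 0F → b02  ; 2F 1F → b12  ; 2F 2F → true ; 2F 3F → b23  ; 2F 4F → b24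
  3F 0F → b03  ; 3F 1F → b13  ; 3F 2F → b23  ; 3F 3F → true ; 3F 4F → b34
  4F 0F → b04  ; 4F 1F → b14  ; 4F 2F → b24  ; 4F 3F → b34  ; 4F 4F → true

patternOf : (Fin 5 → Fin 5 → Bool) → Pattern
patternOf f =
  f 0F 1F ∷ f 0F 2F ∷ f 0F 3F ∷ f 0F 4F ∷ f 1F 2F ∷ f 1F 3F ∷ f 1F 4F ∷ f 2F 3F ∷ f 2F 4F ∷ f 3F 4F ∷ []

shares-patternOf : ∀ f → (∀ i → f i i ≡ true) → (∀ i k → f i k ≡ f k i) →
                   ∀ i k → shares (patternOf f) i k ≡ f i k
shares-patternOf f f-refl f-sym = λ where
  0F 0F → sym (f-refl 0F) ; 0F 1F → refl ; 0F 2F → refl ; 0F 3F → refl ; 0F 4F → refl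
  1F 0F → f-sym 0F 1F ; 1F 1F → sym (f-refl 1F) ; 1F 2F → refl ; 1F 3F → refl ; 1F 4F → refl
  2F 0F → f-sym 0F 2F ; 2F 1F → f-sym 1F 2F ; 2F 2F → sym (f-refl 2F) ; 2F 3F → refl ; 2F 4F → refl
  3F 0F → f-sym 0F 3F ; 3F 1F → f-sym 1F 3F ; 3F 2F → f-sym 2F 3F ; 3F 3F → sym (f-refl 3F) ; 3F 4F → refl
  4F 0F → f-sym 0F 4F ; 4F 1F → f-sym 1F 4F ; 4F 2F → f-sym 2F 4F ; 4F 3F → f-sym 3F 4F ; 4F 4F → sym (f-refl 4F)

transitive : Pattern → Bool
transitive g = ∀ᵇ λ i → ∀ᵇ λ k → shares g i k ⇒ (∀ᵇ λ l → shares g k l ⇒ shares g i l)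

equivalencePatterns : List Pattern
equivalencePatterns = filter (T? ∘ transitive) (allBoolVecs 10)

patternOf-equivalence : ∀ f → (∀ i → f i i ≡ true) → (∀ i k → f i k ≡ f k i) →
                        (∀ i k l → T (f i k) → T (f k l) → T (f i l)) →
                        patternOf f ∈ equivalencePatterns
patternOf-equivalence f f-refl f-sym f-trans =
  ∈-filter⁺ (T? ∘ transitive) (∈-allBoolVecs (patternOf f))
    (∀ᵇ-intro λ i → ∀ᵇ-intro λ k → ⇒-intro λ i∼k → ∀ᵇ-intro λ l → ⇒-intro λ k∼l →
      to (f-trans i k l (from i∼k) (from k∼l)))
  where
  sh = shares-patternOf f f-refl f-sym
  to : ∀ {i k} → T (f i k) → T (shares (patternOf f) i k)
  to {i} {k} = subst T (sym (sh i k))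
  from : ∀ {i k} → T (shares (patternOf f) i k) → T (f i k)
  from {i} {k} = subst T (sh i k)

-- For an equivalence pattern, 5 minus the number of classes.
rank : Pattern → ℕ
rank (b01 ∷ b02 ∷ b03 ∷ b04 ∷ b12 ∷ b13 ∷ b14 ∷ b23 ∷ b24 ∷ b34 ∷ []) =
  indicator (or (b01 ∷ b02 ∷ b03 ∷ b04 ∷ [])) + indicator (or (b12 ∷ b13 ∷ b14 ∷ [])) +
  indicator (or (b23 ∷ b24 ∷ [])) + indicator (or (b34 ∷ []))

disjoint : ∀ {n} → Vec Bool n → Vec Bool n → Bool
disjoint []       []       = true
disjoint (x ∷ xs) (y ∷ ys) = not (x ∧ y) ∧ disjoint xs ys

rainbowFree : Pattern → Pattern → Pattern → Bool
rainbowFree g₀ g₁ g₂ = ∀ᵇ λ m → ∀ᵇ λ s → shares g₀ m s ∧ (m ≠ᵇ s) ⇒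
                        (∀ᵇ λ t → not (shares g₁ s t ∧ shares g₂ m t))

commonNeighbour : Pattern → Pattern → Fin 5 → Fin 5 → Bool
commonNeighbour g h p q = ∃ᵇ λ u → shares g p u ∧ shares h q u

template : Pattern → Pattern → Pattern → Bool
template g₀ g₁ g₂ = ∃ᵇ λ p → ∃ᵇ λ q →
  (p ≠ᵇ q) ∧ commonNeighbour g₀ g₁ p q ∧ commonNeighbour g₁ g₂ p q ∧ commonNeighbour g₂ g₀ p q

admissible : Pattern → Pattern → Pattern → Bool
admissible g₀ g₁ g₂ =
  disjoint g₀ g₂ ∧ disjoint g₁ g₂ ∧ (6 ≤ᵇ rank g₀ + rank g₁ + rank g₂) ∧ rainbowFree g₀ g₁ g₂

verifiedPair : List Pattern → Pattern → Pattern → Bool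
verifiedPair E g₀ g₁ = disjoint g₀ g₁ ⇒ all (λ g₂ → admissible g₀ g₁ g₂ ⇒ template g₀ g₁ g₂) E

-- The candidate list E is λ-bound so that it is computed only once during the check below.
verifiedOn : List Pattern → Bool
verifiedOn E = all (λ g₀ → all (verifiedPair E g₀) E) E

-- Stated as an equation, this is decided once by evaluation; with T the whole check would be
-- re-run wherever the type of `verified` is compared.
verified : verifiedOn equivalencePatterns ≡ true
verified = refl

record Template (g₀ g₁ g₂ : Pattern) : Set where
  field
    p q u v w : Fin 5
    p≢q : p ≢ q
    p∼₀u : T (shares g₀ p u)
    p∼₁v : T (shares g₁ p v)
    p∼₂w : T (shares g₂ p w)
    q∼₁u : T (shares g₁ q u)
    q∼₂v : T (shares g₂ q v)
    q∼₀w : T (shares g₀ q w)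

commonNeighbour-sound : ∀ g h p q → T (commonNeighbour g h p q) →
                        ∃ λ u → T (shares g p u) × T (shares h q u)
commonNeighbour-sound g h p q t =
  let u , t′ = ∃ᵇ-elim {p = λ u → shares g p u ∧ shares h q u} t in u , ∧-elim t′

template-sound : ∀ {g₀ g₁ g₂} → T (template g₀ g₁ g₂) → Template g₀ g₁ g₂
template-sound {g₀} {g₁} {g₂} t =
  let p , t₁ = ∃ᵇ-elim {p = λ p → ∃ᵇ λ q → templateAt p q} t
      q , t₂ = ∃ᵇ-elim {p = templateAt p} t₁
      p≠q , t₃ = ∧-elim t₂
      tu , t₄ = ∧-elim t₃
      tv , tw = ∧-elim t₄
      u , p∼₀u , q∼₁u = commonNeighbour-sound g₀ g₁ p q tu
      v , p∼₁v , q∼₂v = commonNeighbour-sound g₁ g₂ p q tv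
      w , p∼₂w , q∼₀w = commonNeighbour-sound g₂ g₀ p q tw
  in record { p = p ; q = q ; u = u ; v = v ; w = w ; p≢q = ≠ᵇ⇒≢ p≠q
            ; p∼₀u = p∼₀u ; p∼₁v = p∼₁v ; p∼₂w = p∼₂w
            ; q∼₁u = q∼₁u ; q∼₂v = q∼₂v ; q∼₀w = q∼₀w }
  where
  templateAt : Fin 5 → Fin 5 → Bool
  templateAt p q =
    (p ≠ᵇ q) ∧ commonNeighbour g₀ g₁ p q ∧ commonNeighbour g₁ g₂ p q ∧ commonNeighbour g₂ g₀ p q

disjoint-intro : ∀ {n} (xs ys : Vec Bool n) → (∀ j → T (Vec.lookup xs j) → T (Vec.lookup ys j) → ⊥) →
                 T (disjoint xs ys)
disjoint-intro []       []       _     = tt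
disjoint-intro (x ∷ xs) (y ∷ ys) apart =
  ∧-intro (not-∧-intro (apart zero)) (disjoint-intro xs ys (apart ∘ suc))

patterns-disjoint : ∀ g h → (∀ i k → i ≢ k → T (shares g i k) → T (shares h i k) → ⊥) → T (disjoint g h)
patterns-disjoint g@(_ ∷ _ ∷ _ ∷ _ ∷ _ ∷ _ ∷ _ ∷ _ ∷ _ ∷ _ ∷ [])
                  h@(_ ∷ _ ∷ _ ∷ _ ∷ _ ∷ _ ∷ _ ∷ _ ∷ _ ∷ _ ∷ []) apart =
  disjoint-intro g h λ where
    0F → apart 0F 1F λ () ; 1F → apart 0F 2F λ () ; 2F → apart 0F 3F λ () ; 3F → apart 0F 4F λ ()
    4F → apart 1F 2F λ () ; 5F → apart 1F 3F λ () ; 6F → apart 1F 4F λ ()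
    7F → apart 2F 3F λ () ; 8F → apart 2F 4F λ () ; 9F → apart 3F 4F λ ()

rainbowFree-intro : ∀ {g₀ g₁ g₂} →
  (∀ m s t → m ≢ s → T (shares g₀ m s) → T (shares g₁ s t) → T (shares g₂ m t) → ⊥) →
  T (rainbowFree g₀ g₁ g₂)
rainbowFree-intro no-rainbow = ∀ᵇ-intro λ m → ∀ᵇ-intro λ s → ⇒-intro λ ms →
  let m∼s , m≠s = ∧-elim ms
  in ∀ᵇ-intro λ t → not-∧-intro (no-rainbow m s t (≠ᵇ⇒≢ m≠s) m∼s)

verifiedOn-sound : ∀ {E g₀ g₁ g₂} → verifiedOn E ≡ true → g₀ ∈ E → g₁ ∈ E → g₂ ∈ E →
                   T (disjoint g₀ g₁) → T (admissible g₀ g₁ g₂) → T (template g₀ g₁ g₂)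
verifiedOn-sound {E} {g₀} {g₁} t m₀ m₁ m₂ d₀₁ = ⇒-elim (All.lookup (all⁺ _ E pair) m₂)
  where
  row = All.lookup (all⁺ _ E (Equivalence.from T-≡ t)) m₀
  pair = ⇒-elim (All.lookup (all⁺ (verifiedPair E g₀) E row) m₁) d₀₁

admissible⇒template : ∀ {g₀ g₁ g₂} → g₀ ∈ equivalencePatterns → g₁ ∈ equivalencePatterns →
                      g₂ ∈ equivalencePatterns → T (disjoint g₀ g₁) → T (admissible g₀ g₁ g₂) →
                      Template g₀ g₁ g₂
admissible⇒template m₀ m₁ m₂ d₀₁ =
  template-sound ∘ verifiedOn-sound {E = equivalencePatterns} verified m₀ m₁ m₂ d₀₁


vertex : ∀ {n} → Fin 3 → Edge n → Fin n
vertex 0F (a , _ , _) = a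
vertex 1F (_ , b , _) = b
vertex 2F (_ , _ , c) = c

-- The shape of the sum is the normal form of `length (sharedVerts e f)`, see `shared-count`.
private
  at-most-one-yes : ∀ {P Q R : Set} (p? : Dec P) (q? : Dec Q) (r? : Dec R) →
                    ¬ (P × Q) → ¬ (P × R) → ¬ (Q × R) →
                    indicator (does p? ∨ false) +
                      (indicator (does q? ∨ false) + (indicator (does r? ∨ false) + 0)) ≤ 1
  at-most-one-yes (yes p) (yes q) _       ¬pq _   _   = ⊥-elim (¬pq (p , q))
  at-most-one-yes (yes p) (no _)  (yes r) _   ¬pr _   = ⊥-elim (¬pr (p , r))
  at-most-one-yes (no _)  (yes q) (yes r) _   _   ¬qr = ⊥-elim (¬qr (q , r))
  at-most-one-yes (yes _) (no _)  (no _)  _   _   _   = s≤s z≤n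
  at-most-one-yes (no _)  (yes _) (no _)  _   _   _   = s≤s z≤n
  at-most-one-yes (no _)  (no _)  (yes _) _   _   _   = s≤s z≤n
  at-most-one-yes (no _)  (no _)  (no _)  _   _   _   = z≤n

sharedVerts-≤1 : ∀ {n} (e f : Edge n) →
                 (∀ {c d} → c ≢ d → vertex c e ≡ vertex c f → vertex d e ≡ vertex d f → ⊥) →
                 length (sharedVerts e f) ≤ 1
sharedVerts-≤1 {n} e@(a , b , c) f@(a′ , b′ , c′) one-class =
  subst (_≤ 1) (sym shared-count)
    (at-most-one-yes (a Fin.≟ a′) (b Fin.≟ b′) (c Fin.≟ c′)
      (λ (p , q) → one-class {0F} {1F} (λ ()) p q)
      (λ (p , r) → one-class {0F} {2F} (λ ()) p r)
      (λ (q , r) → one-class {1F} {2F} (λ ()) q r))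
  where
  open DecMembership (Product.≡-dec Fin._≟_ (Fin._≟_ {n})) using (_∈?_)
  shared? = λ v → v ∈? vertsOf f
  shared-count : length (sharedVerts e f) ≡
    indicator (does (a Fin.≟ a′) ∨ false) + (indicator (does (b Fin.≟ b′) ∨ false) +
      (indicator (does (c Fin.≟ c′) ∨ false) + 0))
  shared-count =
    trans (length-filter-∷ shared? (0F , a) ((1F , b) ∷ (2F , c) ∷ [])) (cong (_ +_)
      (trans (length-filter-∷ shared? (1F , b) ((2F , c) ∷ [])) (cong (_ +_)
        (length-filter-∷ shared? (2F , c) []))))

module FiveEdges {n} (e : Fin 5 → Edge n) where

  meets : Fin 3 → Fin 5 → Fin 5 → Bool
  meets c i k = does (vertex c (e i) Fin.≟ vertex c (e k))

  meets-refl : ∀ c i → meets c i i ≡ true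
  meets-refl c i = dec-true (vertex c (e i) Fin.≟ vertex c (e i)) refl

  meets-sym : ∀ c i k → meets c i k ≡ meets c k i
  meets-sym c i k =
    does-⇔ (mk⇔ sym sym) (vertex c (e i) Fin.≟ vertex c (e k)) (vertex c (e k) Fin.≟ vertex c (e i))

  classPattern : Fin 3 → Pattern
  classPattern c = patternOf (meets c)

  shares-classPattern : ∀ c i k → shares (classPattern c) i k ≡ meets c i k
  shares-classPattern c = shares-patternOf (meets c) (meets-refl c) (meets-sym c)

  shares⇒≡ : ∀ c i k → T (shares (classPattern c) i k) → vertex c (e i) ≡ vertex c (e k)
  shares⇒≡ c i k t = does⇒ (vertex c (e i) Fin.≟ vertex c (e k)) (subst T (shares-classPattern c i k) t)

  classPattern-equivalence : ∀ c → classPattern c ∈ equivalencePatterns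
  classPattern-equivalence c = patternOf-equivalence (meets c) (meets-refl c) (meets-sym c)
    (λ i k l ik kl →
      ⇒does (vc i Fin.≟ vc l) (trans (does⇒ (vc i Fin.≟ vc k) ik) (does⇒ (vc k Fin.≟ vc l) kl)))
    where vc = λ i → vertex c (e i)

  -- `repeats` counts the recurring vertex occurrences edge by edge, `rank` class by class.
  repeats-vertices :
    repeats (Product.≡-dec Fin._≟_ Fin._≟_) (concatMap vertsOf (e 0F ∷ e 1F ∷ e 2F ∷ e 3F ∷ e 4F ∷ [])) ≡
    rank (classPattern 0F) + rank (classPattern 1F) + rank (classPattern 2F)
  repeats-vertices = interchange (r 0F 0F) (r 1F 0F) (r 2F 0F) (r 0F 1F) (r 1F 1F) (r 2F 1F)
                                 (r 0F 2F) (r 1F 2F) (r 2F 2F) (r 0F 3F) (r 1F 3F) (r 2F 3F)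
    where
    later : Fin 5 → List (Fin 5)
    later 0F = 1F ∷ 2F ∷ 3F ∷ 4F ∷ []
    later 1F = 2F ∷ 3F ∷ 4F ∷ []
    later 2F = 3F ∷ 4F ∷ []
    later 3F = 4F ∷ []
    later 4F = []
    r : Fin 3 → Fin 5 → ℕ
    r c i = indicator (or (map (meets c i) (later i)))
    interchange : ∀ a₀ b₀ c₀ a₁ b₁ c₁ a₂ b₂ c₂ a₃ b₃ c₃ →
      a₀ + (b₀ + (c₀ + (a₁ + (b₁ + (c₁ + (a₂ + (b₂ + (c₂ + (a₃ + (b₃ + (c₃ + 0)))))))))))
        ≡ (a₀ + a₁ + a₂ + a₃) + (b₀ + b₁ + b₂ + b₃) + (c₀ + c₁ + c₂ + c₃)
    interchange = solve-∀

  few-vertices⇒dense : length (unionVerts (e 0F ∷ e 1F ∷ e 2F ∷ e 3F ∷ e 4F ∷ [])) ≤ 9 →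
                       6 ≤ rank (classPattern 0F) + rank (classPattern 1F) + rank (classPattern 2F)
  few-vertices⇒dense = complement-≥ (begin
    length (unionVerts S) + (rank (classPattern 0F) + rank (classPattern 1F) + rank (classPattern 2F))
      ≡⟨ cong (length (unionVerts S) +_) (sym repeats-vertices) ⟩
    length (unionVerts S) + repeats (Product.≡-dec Fin._≟_ Fin._≟_) (concatMap vertsOf S)
      ≡⟨ length-deduplicate+repeats (Product.≡-dec Fin._≟_ Fin._≟_) (concatMap vertsOf S) ⟩
    9 + 6 ∎)
    where
    open ≡-Reasoning
    S = e 0F ∷ e 1F ∷ e 2F ∷ e 3F ∷ e 4F ∷ []


module Construction (N : ℕ) .{{_ : NonZero N}} (A : List ℕ) (A⊆[N] : SubsetOfRange N A)
                    (no-solution : ¬ HasNontrivialSolution A) where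

  m : ℕ
  m = 3 * N

  instance
    m≢0 : NonZero m
    m≢0 = m*n≢0 3 N

  params : List (ℕ × ℕ)
  params = cartesianProduct A (upTo N)

  slope∈A : ∀ {p} → p ∈ params → proj₁ p ∈ A
  slope∈A {p} p∈ = proj₁ (∈-cartesianProduct⁻ A (upTo N) {p} p∈)

  value<m : ∀ {p} → p ∈ params → ∀ c → value c p < m
  value<m {a , x} p∈ c = begin-strict
    toℕ c * a + x  <⟨ +-mono-≤-< (*-mono-≤ (Fin.toℕ≤pred[n] c) a≤N) x<N ⟩
    2 * N + N      ≡⟨ +-comm (2 * N) N ⟩
    3 * N          ∎
    where
    open ≤-Reasoning
    a≤N = proj₂ (All.lookup (proj₂ A⊆[N]) (slope∈A p∈))
    x<N = ∈-upTo⁻ (proj₂ (∈-cartesianProduct⁻ A (upTo N) p∈))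

  -- The edge {x, x + a, x + 2a}; reducing mod m only serves to land in Fin m, see value<m.
  edge : ℕ × ℕ → Edge m
  edge p = value 0F p mod m , value 1F p mod m , value 2F p mod m

  vertex-edge : ∀ c p → vertex c (edge p) ≡ value c p mod m
  vertex-edge 0F p = refl
  vertex-edge 1F p = refl
  vertex-edge 2F p = refl

  ≡vertex⇒meet : ∀ c {p q} → p ∈ params → q ∈ params → vertex c (edge p) ≡ vertex c (edge q) → Meet c p q
  ≡vertex⇒meet c {p} {q} p∈ q∈ eq = begin
    value c p                    ≡⟨ sym (toℕ-mod p∈) ⟩
    toℕ (vertex c (edge p))      ≡⟨ cong toℕ eq ⟩
    toℕ (vertex c (edge q))      ≡⟨ toℕ-mod q∈ ⟩
    value c q                    ∎
    where
    open ≡-Reasoning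
    toℕ-mod : ∀ {r} → r ∈ params → toℕ (vertex c (edge r)) ≡ value c r
    toℕ-mod {r} r∈ = trans (cong toℕ (vertex-edge c r)) (trans (Fin.toℕ-fromℕ< _) (m<n⇒m%n≡m (value<m r∈ c)))

  edge-injective : ∀ {p q} → p ∈ params → q ∈ params → edge p ≡ edge q → p ≡ q
  edge-injective p∈ q∈ eq = meet-twice⇒≡ {0F} {1F} (λ ())
    (≡vertex⇒meet 0F p∈ q∈ (cong (vertex 0F) eq)) (≡vertex⇒meet 1F p∈ q∈ (cong (vertex 1F) eq))

  H : TripartiteHypergraph m
  H = record
    { edges  = map edge params
    ; unique = Unique-map⁺ edge-injective (Unique.cartesianProduct⁺ (proj₁ A⊆[N]) (Unique.upTo⁺ N))
    }

  numEdges-H : numEdges H ≡ length A * N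
  numEdges-H = trans (length-map edge params)
    (trans (length-cartesianProduct A (upTo N)) (cong (length A *_) (length-upTo N)))

  H-linear : Linear H
  H-linear e f e∈H f∈H e≢f with ∈-map⁻ edge e∈H | ∈-map⁻ edge f∈H
  ... | p , p∈ , refl | q , q∈ , refl = sharedVerts-≤1 (edge p) (edge q) λ {c} {d} c≢d e₁ e₂ →
    e≢f (cong edge (meet-twice⇒≡ c≢d (≡vertex⇒meet c p∈ q∈ e₁) (≡vertex⇒meet d p∈ q∈ e₂)))

  rainbow-impossible : ∀ {p q r} → p ∈ params → q ∈ params → r ∈ params → p ≢ q →
                       Meet 0F p q → Meet 1F q r → Meet 2F p r → ⊥
  rainbow-impossible {p} {q} {r} p∈ q∈ r∈ p≢q p∼₀q q∼₁r p∼₂r = no-solution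
    ( proj₁ q , proj₁ p , proj₁ r , proj₁ q , slope∈A q∈ , slope∈A p∈ , slope∈A r∈ , slope∈A q∈
    , progression⇒solution (proj₁ q) (proj₁ p) (proj₁ r) (rainbow⇒progression {p} {q} {r} p∼₀q q∼₁r p∼₂r)
    , λ (q≡p , _) → p≢q (meet-same-slope⇒≡ 0F p∼₀q (sym q≡p)))

  template-impossible : ∀ {p q u v w} → p ∈ params → u ∈ params → v ∈ params → w ∈ params → p ≢ q →
    Meet 0F p u → Meet 1F p v → Meet 2F p w → Meet 1F q u → Meet 2F q v → Meet 0F q w → ⊥
  template-impossible {p} {q} {u} {v} {w} p∈ u∈ v∈ w∈ p≢q p∼₀u p∼₁v p∼₂w q∼₁u q∼₂v q∼₀w =
    no-solution
      ( proj₁ u , proj₁ w , proj₁ v , proj₁ p , slope∈A u∈ , slope∈A w∈ , slope∈A v∈ , slope∈A p∈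
      , template⇒solution {p} {q} {u} {v} {w} p∼₀u p∼₁v p∼₂w q∼₁u q∼₂v q∼₀w
      , nontrivial)
    where
    -- With equal slopes, u and v coincide with p, and then q meets p in two classes.
    nontrivial : ¬ (proj₁ u ≡ proj₁ w × proj₁ w ≡ proj₁ v × proj₁ v ≡ proj₁ p)
    nontrivial (u≡w , w≡v , v≡p) = p≢q (sym (meet-twice⇒≡ {1F} {2F} (λ ())
      (trans q∼₁u (cong (value 1F) (sym p≡u))) (trans q∼₂v (cong (value 2F) (sym p≡v)))))
      where
      p≡u = meet-same-slope⇒≡ 0F p∼₀u (sym (trans u≡w (trans w≡v v≡p)))
      p≡v = meet-same-slope⇒≡ 1F p∼₁v (sym v≡p)

  module FiveEdgesOfH (e : Fin 5 → Edge m) (e-injective : ∀ {i k} → e i ≡ e k → i ≡ k)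
                      (e∈H : ∀ i → e i ∈ edges H) where
    open FiveEdges e

    P : Fin 5 → ℕ × ℕ
    P i = proj₁ (∈-map⁻ edge (e∈H i))

    P∈params : ∀ i → P i ∈ params
    P∈params i = proj₁ (proj₂ (∈-map⁻ edge (e∈H i)))

    e≡edge∘P : ∀ i → e i ≡ edge (P i)
    e≡edge∘P i = proj₂ (proj₂ (∈-map⁻ edge (e∈H i)))

    P-injective : ∀ {i k} → P i ≡ P k → i ≡ k
    P-injective {i} {k} eq = e-injective (trans (e≡edge∘P i) (trans (cong edge eq) (sym (e≡edge∘P k))))

    shares⇒meet : ∀ c i k → T (shares (classPattern c) i k) → Meet c (P i) (P k)
    shares⇒meet c i k s = ≡vertex⇒meet c (P∈params i) (P∈params k)
      (subst₂ (λ x y → vertex c x ≡ vertex c y) (e≡edge∘P i) (e≡edge∘P k) (shares⇒≡ c i k s))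

    classes-disjoint : ∀ c d → c ≢ d → T (disjoint (classPattern c) (classPattern d))
    classes-disjoint c d c≢d = patterns-disjoint _ _ λ i k i≢k s t →
      i≢k (P-injective (meet-twice⇒≡ c≢d (shares⇒meet c i k s) (shares⇒meet d i k t)))

    classes-rainbowFree : T (rainbowFree (classPattern 0F) (classPattern 1F) (classPattern 2F))
    classes-rainbowFree = rainbowFree-intro λ i k l i≢k s₀ s₁ s₂ →
      rainbow-impossible (P∈params i) (P∈params k) (P∈params l) (i≢k ∘ P-injective)
        (shares⇒meet 0F i k s₀) (shares⇒meet 1F k l s₁) (shares⇒meet 2F i l s₂)

    no-template : Template (classPattern 0F) (classPattern 1F) (classPattern 2F) → ⊥
    no-template t = template-impossible (P∈params p) (P∈params u) (P∈params v) (P∈params w) (p≢q ∘ P-injective)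
      (shares⇒meet 0F p u p∼₀u) (shares⇒meet 1F p v p∼₁v) (shares⇒meet 2F p w p∼₂w)
      (shares⇒meet 1F q u q∼₁u) (shares⇒meet 2F q v q∼₂v) (shares⇒meet 0F q w q∼₀w)
      where open Template t

    not-dense : 6 ≤ rank (classPattern 0F) + rank (classPattern 1F) + rank (classPattern 2F) → ⊥
    not-dense six = no-template (admissible⇒template
      (classPattern-equivalence 0F) (classPattern-equivalence 1F) (classPattern-equivalence 2F)
      (classes-disjoint 0F 1F λ ())
      (∧-intro (classes-disjoint 0F 2F λ ()) (∧-intro (classes-disjoint 1F 2F λ ())
        (∧-intro (≤⇒≤ᵇ six) classes-rainbowFree))))

  H-free : Free 9 5 H
  H-free (S@(_ ∷ _ ∷ _ ∷ _ ∷ _ ∷ []) , refl , !S , S⊆H , ≤9) =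
    FiveEdgesOfH.not-dense (lookup S) (Unique-lookup-injective !S) (λ i → All.lookup S⊆H (∈-lookup i))
      (FiveEdges.few-vertices⇒dense (lookup S) ≤9)
  H-free ([]                        , () , _)
  H-free (_ ∷ []                    , () , _)
  H-free (_ ∷ _ ∷ []                , () , _)
  H-free (_ ∷ _ ∷ _ ∷ []            , () , _)
  H-free (_ ∷ _ ∷ _ ∷ _ ∷ []        , () , _)
  H-free (_ ∷ _ ∷ _ ∷ _ ∷ _ ∷ _ ∷ _ , () , _)


proposition4p14 :
    (∃ λ a → ∃ λ b → ∃ λ K → 0 < a × 0 < b × 0 < K ×
      (∀ n → 0 < n → (H : TripartiteHypergraph n) → Linear H → Free 9 5 H →
        numEdges H ^ b * n ^ a ≤ K ^ b * n ^ (2 * b))) →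
    (∃ λ a′ → ∃ λ b′ → ∃ λ K′ → 0 < a′ × 0 < b′ × 0 < K′ ×
      (∀ n → 0 < n → (A : List ℕ) → SubsetOfRange n A → ¬ HasNontrivialSolution A →
        length A ^ b′ * n ^ a′ ≤ K′ ^ b′ * n ^ b′))
proposition4p14 (a , b , K , 0<a , 0<b , 0<K , hypergraph-bound) =
  a , b , 9 * K , 0<a , 0<b , *-monoʳ-< 9 0<K , set-bound
  where
  set-bound : ∀ n → 0 < n → (A : List ℕ) → SubsetOfRange n A → ¬ HasNontrivialSolution A →
              length A ^ b * n ^ a ≤ (9 * K) ^ b * n ^ b
  set-bound n 0<n A A⊆[n] no-solution = tripled-bound (length A) n K a b
    (subst (λ k → k ^ b * m ^ a ≤ K ^ b * m ^ (2 * b)) numEdges-H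
      (hypergraph-bound m (>-nonZero⁻¹ m) H H-linear H-free))
    where
    instance
      n≢0 = >-nonZero 0<n
    open Construction n A A⊆[n] no-solution
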